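{- Let $R,S,T\in\mathbf{LT}$ with $S\subseteq R(\to 0)$, $T\subseteq R(\to1)$, and let $\sigma\in 2^{<\omega}$ satisfy $T=\sigma\cdot S$ and $\mathrm{lh}(\sigma)\le\mathrm{lh}(\mathrm{stem}(S))=\mathrm{lh}(\mathrm{stem}(T))$. Then $U=S\cup T\in\mathbf{LT}$, $\mathrm{stem}(U)=\mathrm{stem}(R)$, $S=U(\to0)$ and $T=U(\to1)$.
   Context: Binary strings $2^{<\omega}$; for $s,t\in 2^{<\omega}$ with $\mathrm{lh}(s)\le\mathrm{lh}(t)$, $s\cdot t$ has length $\mathrm{lh}(t)$ with $(s\cdot t)(k)=t(k)+s(k)\bmod 2$ for $k<\mathrm{lh}(s)$, $=t(k)$ otherwise; if $\mathrm{lh}(s)>\mathrm{lh}(t)$, $s\cdot t=(s{\restriction}\mathrm{lh}(t))\cdot t$; $s\cdot T=\{s\cdot t:t\in T\}$; $T{\restriction}s=\{t\in T:s\subseteq t\lor t\subseteq s\}$. The stem of a perfect tree $T\subseteq2^{<\omega}$ is the largest $s\in T$ with $T=T{\restriction}s$. $\mathbf{LT}$ is the set of perfect trees $T$ for which there are nonempty strings $q^n_i$ ($n<\omega,i<2$) with $\mathrm{lh}(q^n_0)=\mathrm{lh}(q^n_1)$, $q^n_i(0)=i$, such that $T$ consists of all initial segments of strings $\mathrm{stem}(T)^\frown q^0_{i(0)}{}^\frown\cdots{}^\frown q^n_{i(n)}$ ($n<\omega$, $i(k)\in\{0,1\}$). For $T\in\mathbf{LT}$ and $i\in\{0,1\}$,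 $T(\to i)=T{\restriction}(\mathrm{stem}(T)^\frown i)$. -}

module Defs where

open import Data.Bool using (Bool; true; false; _xor_)
open import Data.List using (List; []; _∷_; _++_; length; [_])
open import Data.Nat using (ℕ; zero; suc; _≤_)
open import Data.Product using (Σ; ∃; _×_; _,_)
open import Data.Sum using (_⊎_)
open import Relation.Binary.PropositionalEquality using (_≡_)
open import Relation.Nullary using (¬_)
open import Relation.Unary using (Pred; _∈_; _⊆_; _≐_)
open import Level using (0ℓ)

Str : Set
Str = List Bool

StrSet : Set₁
StrSet = Pred Str 0ℓ

-- s ⊑ t : s is an initial segment of t (s ⊆ t in the paper)
_⊑_ : Str → Str → Set
s ⊑ t = ∃ λ u → s ++ u ≡ t

_·_ : Str → Str → Str
[] · t = t
(a ∷ s) · [] = []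
(a ∷ s) · (b ∷ t) = (a xor b) ∷ (s · t)

_·ˢ_ : Str → StrSet → StrSet
(s ·ˢ T) u = ∃ λ t → t ∈ T × u ≡ s · t

_↾_ : StrSet → Str → StrSet
(T ↾ s) t = t ∈ T × (s ⊑ t ⊎ t ⊑ s)

IsTree : StrSet → Set
IsTree T = (∃ λ s → s ∈ T) × (∀ s t → t ⊑ s → s ∈ T → t ∈ T)

Perfect : StrSet → Set
Perfect T = IsTree T ×
  (∀ s → s ∈ T → ∃ λ t → ∃ λ u → t ∈ T × u ∈ T × s ⊑ t × s ⊑ u
                   × ¬ (t ⊑ u) × ¬ (u ⊑ t))

IsStem : StrSet → Str → Set
IsStem T s = s ∈ T × T ≐ (T ↾ s) ×
  (∀ s′ → s′ ∈ T → T ≐ (T ↾ s′) → s′ ⊑ s)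

conc : (ℕ → Bool → Str) → (ℕ → Bool) → ℕ → Str
conc q i zero = q zero (i zero)
conc q i (suc n) = conc q i n ++ q (suc n) (i (suc n))

LT : StrSet → Set
LT T = Perfect T × Σ Str λ s → IsStem T s ×
  Σ (ℕ → Bool → Str) λ q →
    (∀ n → length (q n false) ≡ length (q n true)) ×
    (∀ n → (∃ λ r → q n false ≡ false ∷ r) × (∃ λ r → q n true ≡ true ∷ r)) ×
    T ≐ (λ t → ∃ λ n → ∃ λ (i : ℕ → Bool) → t ⊑ (s ++ conc q i n))

-- T(→ i), given the stem s of T
_⟶_[_] : StrSet → Str → Bool → StrSet
T ⟶ s [ i ] = T ↾ (s ++ [ i ])

module Submission where

-- Write Branches s q for the tree of all prefixes of s⁀q(0,i₀)⁀…⁀q(n,iₙ),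
-- so T ∈ LT says T = Branches stem(T) q for a splitting system q.
--   * Because S hangs from r⁀0 and is perfect, r⁀0 ∈ S and r⁀0 ⊑ stem(S),
--     i.e. stem(S) = r⁀0⁀a; likewise stem(T) = r⁀1⁀b with lh a = lh b.
--   * Since lh σ ≤ lh stem(S), σ acts on S by rewriting the stem only:
--     σ·stem(S) = stem(T) and T = Branches stem(T) q with the SAME q.
--   * Branches (r⁀0⁀a) q ∪ Branches (r⁀1⁀b) q = Branches r q′, where q′
--     prepends the splitting level (0⁀a, 1⁀b) to q; so S ∪ T ∈ LT.
--   * The union is perfect, r is its stem (every node is comparable with r,
--     and r⁀0, r⁀1 both belong to it), and its two halves above r are S, T.

open import Defs
open import Data.Bool using (Bool; true; false; not; _xor_)
open import Data.Bool.Properties using (not-¬)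
open import Data.List using ([]; _∷_; _++_; length; [_])
open import Data.List.Properties using (++-assoc; ++-identityʳ)
open import Data.Nat using (ℕ; zero; suc; _≤_; s≤s)
open import Data.Nat.Properties using (suc-injective)
open import Data.Product using (∃; _×_; _,_; proj₁; proj₂)
open import Data.Sum using (_⊎_; inj₁; inj₂)
open import Data.Empty using (⊥-elim)
open import Relation.Nullary using (¬_)
open import Relation.Binary.PropositionalEquality
  using (_≡_; refl; sym; trans; cong; subst)
open import Relation.Unary using (_⊆_; _≐_; _∪_)
open import Relation.Unary.Properties using (≐-trans)

Comparable : Str → Str → Set
Comparable x y = x ⊑ y ⊎ y ⊑ x

⊑-refl : ∀ x → x ⊑ x
⊑-refl x = [] , ++-identityʳ x

⊑-++ : ∀ x y → x ⊑ (x ++ y)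
⊑-++ x y = y , refl

⊑-trans : ∀ {x y z} → x ⊑ y → y ⊑ z → x ⊑ z
⊑-trans {x} (u , refl) (v , refl) = u ++ v , sym (++-assoc x u v)

∷-⊑-∷ : ∀ {a b x y} → (a ∷ x) ⊑ (b ∷ y) → a ≡ b × x ⊑ y
∷-⊑-∷ (u , refl) = refl , (u , refl)

⊑-cong-∷ : ∀ a {x y} → x ⊑ y → (a ∷ x) ⊑ (a ∷ y)
⊑-cong-∷ a (u , refl) = u , refl

∷-⋢-[] : ∀ {a x} → (a ∷ x) ⊑ [] → ∀ {A : Set} → A
∷-⋢-[] (_ , ())

comparable-sym : ∀ {x y} → Comparable x y → Comparable y x
comparable-sym (inj₁ p) = inj₂ p
comparable-sym (inj₂ p) = inj₁ p

comparable-∷ : ∀ {a b x y} → Comparable (a ∷ x) (b ∷ y) → a ≡ b × Comparable x y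
comparable-∷ (inj₁ p) = proj₁ (∷-⊑-∷ p) , inj₁ (proj₂ (∷-⊑-∷ p))
comparable-∷ (inj₂ p) = sym (proj₁ (∷-⊑-∷ p)) , inj₂ (proj₂ (∷-⊑-∷ p))

prefixes-comparable : ∀ {t u p} → t ⊑ p → u ⊑ p → Comparable t u
prefixes-comparable {[]} {u} _ _ = inj₁ (u , refl)
prefixes-comparable {_ ∷ _} {[]} _ _ = inj₂ (_ , refl)
prefixes-comparable {_ ∷ _} {_ ∷ _} {[]} p _ = ∷-⋢-[] p
prefixes-comparable {a ∷ _} {_ ∷ _} {_ ∷ _} h k with ∷-⊑-∷ h | ∷-⊑-∷ k
... | refl , h′ | refl , k′ with prefixes-comparable h′ k′
... | inj₁ x = inj₁ (⊑-cong-∷ a x)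
... | inj₂ x = inj₂ (⊑-cong-∷ a x)

⊑-antisym : ∀ {x y} → x ⊑ y → y ⊑ x → x ≡ y
⊑-antisym {[]} {[]} _ _ = refl
⊑-antisym {[]} {_ ∷ _} _ q = ∷-⋢-[] q
⊑-antisym {_ ∷ _} {[]} p _ = ∷-⋢-[] p
⊑-antisym {a ∷ _} {_ ∷ _} p q with ∷-⊑-∷ p | ∷-⊑-∷ q
... | refl , p′ | _ , q′ = cong (a ∷_) (⊑-antisym p′ q′)

comparable-same-length : ∀ {x y} → Comparable x y → length x ≡ length y → x ≡ y
comparable-same-length {[]} {[]} _ _ = refl
comparable-same-length {a ∷ _} {_ ∷ _} c e with comparable-∷ c
... | refl , c′ = cong (a ∷_) (comparable-same-length c′ (suc-injective e))

comparable-parent : ∀ r c x → Comparable (r ++ [ c ]) x → Comparable r x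
comparable-parent r c x (inj₁ p) = inj₁ (⊑-trans (⊑-++ r [ c ]) p)
comparable-parent r c x (inj₂ p) = prefixes-comparable (⊑-++ r [ c ]) p

⊑-fork : ∀ r {c x} → Comparable (r ++ [ c ]) x → Comparable (r ++ [ not c ]) x → x ⊑ r
⊑-fork r {x = []} _ _ = r , refl
⊑-fork [] {x = _ ∷ _} c₀ c₁ =
  ⊥-elim (not-¬ (sym (proj₁ (comparable-∷ c₀))) (sym (proj₁ (comparable-∷ c₁))))
⊑-fork (a ∷ r) {x = _ ∷ _} c₀ c₁ with comparable-∷ c₀
... | refl , c₀′ = ⊑-cong-∷ a (⊑-fork r c₀′ (proj₂ (comparable-∷ c₁)))

length-after-fork : ∀ (r : Str) {s s′ c d a b} → s ≡ r ++ c ∷ a → s′ ≡ r ++ d ∷ b →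
  length s ≡ length s′ → length a ≡ length b
length-after-fork [] refl refl e = suc-injective e
length-after-fork (_ ∷ r) refl refl e = length-after-fork r refl refl (suc-injective e)

·-length : ∀ σ t → length (σ · t) ≡ length t
·-length [] t = refl
·-length (a ∷ σ) [] = refl
·-length (a ∷ σ) (b ∷ t) = cong suc (·-length σ t)

·-mono : ∀ σ {x y} → x ⊑ y → (σ · x) ⊑ (σ · y)
·-mono [] p = p
·-mono (a ∷ σ) {[]} p = _ , refl
·-mono (a ∷ σ) {b ∷ x} {[]} p = ∷-⋢-[] p
·-mono (a ∷ σ) {b ∷ x} {c ∷ y} p with ∷-⊑-∷ p
... | refl , p′ = ⊑-cong-∷ (a xor b) (·-mono σ p′)

-- σ only modifies the first lh σ letters, so it leaves a tail beyond x alone.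
·-++ : ∀ σ x c → length σ ≤ length x → σ · (x ++ c) ≡ (σ · x) ++ c
·-++ [] x c _ = refl
·-++ (a ∷ σ) (b ∷ x) c (s≤s h) = cong ((a xor b) ∷_) (·-++ σ x c h)

Hangs : Str → StrSet → Set
Hangs p X = ∀ {x} → X x → Comparable p x

-- A perfect tree contains every string comparable with all of its nodes:
-- a node of X splits into two incomparable nodes, one of which extends p.
perfect-hangs-contains : ∀ {X p} → Perfect X → Hangs p X → X p
perfect-hangs-contains {p = p} (((x , x∈) , closed) , splits) hangs
  with splits x x∈
... | t , u , t∈ , u∈ , _ , _ , t⋢u , u⋢t with hangs t∈ | hangs u∈
... | inj₁ p⊑t | _ = closed _ p p⊑t t∈
... | inj₂ _ | inj₁ p⊑u = closed _ p p⊑u u∈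
... | inj₂ t⊑p | inj₂ u⊑p with prefixes-comparable t⊑p u⊑p
... | inj₁ t⊑u = ⊥-elim (t⋢u t⊑u)
... | inj₂ u⊑t = ⊥-elim (u⋢t u⊑t)

-- If p ∈ X and X hangs from p, then X = X ↾ p, so p lies below the stem.
hangs-below-stem : ∀ {X s p} → IsStem X s → X p → Hangs p X → p ⊑ s
hangs-below-stem (_ , _ , maximal) p∈ hangs =
  maximal _ p∈ ((λ x∈ → x∈ , hangs x∈) , proj₁)

stem-unique : ∀ {X s s′} → IsStem X s → IsStem X s′ → s ≡ s′
stem-unique (s∈ , X↾s , max) (s′∈ , X↾s′ , max′) =
  ⊑-antisym (max′ _ s∈ X↾s) (max _ s′∈ X↾s′)

stem-by-length : ∀ {X s t} → IsStem X s → X t → length t ≡ length s → t ≡ s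
stem-by-length ((_ , (X↾s , _) , _)) t∈ e =
  comparable-same-length (comparable-sym (proj₂ (X↾s t∈))) e

hanging-stem : ∀ {X s} r c → Perfect X → IsStem X s → Hangs (r ++ [ c ]) X →
  ∃ λ a → s ≡ r ++ c ∷ a
hanging-stem r c perfect stem hangs
  with hangs-below-stem stem (perfect-hangs-contains perfect hangs) hangs
... | a , eq = a , trans (sym eq) (++-assoc r [ c ] a)

Branches : Str → (ℕ → Bool → Str) → StrSet
Branches s q t = ∃ λ n → ∃ λ (i : ℕ → Bool) → t ⊑ (s ++ conc q i n)

Splitting : (ℕ → Bool → Str) → Set
Splitting q = (∀ n → length (q n false) ≡ length (q n true)) ×
  (∀ n → (∃ λ r → q n false ≡ false ∷ r) × (∃ λ r → q n true ≡ true ∷ r))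

_◃_ : (Bool → Str) → (ℕ → Bool → Str) → ℕ → Bool → Str
(q₀ ◃ q) zero = q₀
(q₀ ◃ q) (suc n) = q n

_∷ᶜ_ : Bool → (ℕ → Bool) → ℕ → Bool
(c ∷ᶜ i) zero = c
(c ∷ᶜ i) (suc n) = i n

fork : Str → Str → Bool → Str
fork a _ false = false ∷ a
fork _ b true = true ∷ b

fork-splitting : ∀ {a b q} → length a ≡ length b → Splitting q → Splitting (fork a b ◃ q)
fork-splitting {a} {b} lab (lengths , heads) = lengths′ , heads′
  where
  lengths′ : ∀ n → length ((fork a b ◃ _) n false) ≡ length ((fork a b ◃ _) n true)
  lengths′ zero = cong suc lab
  lengths′ (suc n) = lengths n
  heads′ : ∀ n → (∃ λ r → (fork a b ◃ _) n false ≡ false ∷ r)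
                × (∃ λ r → (fork a b ◃ _) n true ≡ true ∷ r)
  heads′ zero = (a , refl) , (b , refl)
  heads′ (suc n) = heads n

conc-suc : ∀ q i n →
  conc q i (suc n) ≡ q zero (i zero) ++ conc (λ k → q (suc k)) (λ k → i (suc k)) n
conc-suc q i zero = refl
conc-suc q i (suc n) =
  trans (cong (_++ q (suc (suc n)) (i (suc (suc n)))) (conc-suc q i n))
        (++-assoc (q zero (i zero)) _ _)

branches-◃ : ∀ r q₀ q →
  (Branches (r ++ q₀ false) q ∪ Branches (r ++ q₀ true) q) ≐ Branches r (q₀ ◃ q)
branches-◃ r q₀ q = (λ { (inj₁ x∈) → into false x∈ ; (inj₂ x∈) → into true x∈ })
                  , λ { (n , i , p) → out n i p }
  where
  regroup : ∀ c i n → (r ++ q₀ c) ++ conc q i n ≡ r ++ conc (q₀ ◃ q) (c ∷ᶜ i) (suc n)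
  regroup c i n = trans (++-assoc r (q₀ c) _)
                        (cong (r ++_) (sym (conc-suc (q₀ ◃ q) (c ∷ᶜ i) n)))
  into : ∀ c {x} → Branches (r ++ q₀ c) q x → Branches r (q₀ ◃ q) x
  into c (n , i , p) = suc n , c ∷ᶜ i , subst (_ ⊑_) (regroup c i n) p
  side : ∀ c {x} → Branches (r ++ q₀ c) q x →
    (Branches (r ++ q₀ false) q ∪ Branches (r ++ q₀ true) q) x
  side false = inj₁
  side true = inj₂
  out : ∀ {x} n i → x ⊑ (r ++ conc (q₀ ◃ q) i n) →
    (Branches (r ++ q₀ false) q ∪ Branches (r ++ q₀ true) q) x
  out zero i p = side (i zero) (zero , i , ⊑-trans p (⊑-++ _ _))
  out (suc n) i p = side (i zero) (n , (λ k → i (suc k)) ,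
    subst (_ ⊑_) (trans (cong (r ++_) (conc-suc (q₀ ◃ q) i n)) (sym (++-assoc r _ _))) p)

∪-cong : ∀ {A A′ B B′ : StrSet} → A ≐ A′ → B ≐ B′ → (A ∪ B) ≐ (A′ ∪ B′)
∪-cong (A⊆ , ⊆A) (B⊆ , ⊆B) =
  (λ { (inj₁ x) → inj₁ (A⊆ x) ; (inj₂ x) → inj₂ (B⊆ x) }) ,
  (λ { (inj₁ x) → inj₁ (⊆A x) ; (inj₂ x) → inj₂ (⊆B x) })

glue-branches : ∀ {S T : StrSet} {sS sT} r {a b} q →
  S ≐ Branches sS q → T ≐ Branches sT q → sS ≡ r ++ false ∷ a → sT ≡ r ++ true ∷ b →
  (S ∪ T) ≐ Branches r (fork a b ◃ q)
glue-branches r {a} {b} q S≐ T≐ refl refl = ≐-trans (∪-cong S≐ T≐) (branches-◃ r (fork a b) q)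

branches-translate : ∀ {S T σ s s′ q} → IsTree T → T ≐ (σ ·ˢ S) →
  S ≐ Branches s q → length σ ≤ length s → σ · s ≡ s′ → T ≐ Branches s′ q
branches-translate {T = T} {σ} {s} {q = q} (_ , closed) (T⊆σS , σS⊆T) (S⊆B , B⊆S) σ≤ σs≡s′ =
  to , from
  where
  shift : ∀ c → σ · (s ++ c) ≡ _ ++ c
  shift c = trans (·-++ σ s c σ≤) (cong (_++ c) σs≡s′)
  to : T ⊆ Branches _ q
  to t∈ with T⊆σS t∈
  ... | u , u∈ , refl with S⊆B u∈
  ... | n , i , p = n , i , subst (_ ⊑_) (shift (conc q i n)) (·-mono σ p)
  from : Branches _ q ⊆ T
  from (n , i , p) = closed _ _ p (subst T (shift (conc q i n))
    (σS⊆T (_ , B⊆S (n , i , ⊑-refl _) , refl)))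

perfect-∪ : ∀ {S T} → Perfect S → Perfect T → Perfect (S ∪ T)
perfect-∪ {S} {T} (((x , x∈) , closedS) , splitsS) ((_ , closedT) , splitsT) =
  ((x , inj₁ x∈) , closed) , splits
  where
  closed : ∀ s t → t ⊑ s → (S ∪ T) s → (S ∪ T) t
  closed s t p (inj₁ s∈) = inj₁ (closedS s t p s∈)
  closed s t p (inj₂ s∈) = inj₂ (closedT s t p s∈)
  splits : ∀ s → (S ∪ T) s → ∃ λ t → ∃ λ u → (S ∪ T) t × (S ∪ T) u × s ⊑ t × s ⊑ u
                   × ¬ (t ⊑ u) × ¬ (u ⊑ t)
  splits s (inj₁ s∈) with splitsS s s∈
  ... | t , u , t∈ , u∈ , rest = t , u , inj₁ t∈ , inj₁ u∈ , rest
  splits s (inj₂ s∈) with splitsT s s∈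
  ... | t , u , t∈ , u∈ , rest = t , u , inj₂ t∈ , inj₂ u∈ , rest

crossing-node : ∀ {A B : StrSet} r {c x} → IsTree A → A r →
  Hangs (r ++ [ not c ]) B → B x → Comparable (r ++ [ c ]) x → A x
crossing-node r (_ , closed) r∈ hangsB x∈ cmp = closed r _ (⊑-fork r cmp (hangsB x∈)) r∈

module Glue {S T : StrSet} (r : Str) (perfS : Perfect S) (perfT : Perfect T)
  (hangS : Hangs (r ++ [ false ]) S) (hangT : Hangs (r ++ [ true ]) T) where

  r0∈S : S (r ++ [ false ])
  r0∈S = perfect-hangs-contains perfS hangS

  r1∈T : T (r ++ [ true ])
  r1∈T = perfect-hangs-contains perfT hangT

  r∈S : S r
  r∈S = proj₂ (proj₁ perfS) _ r (⊑-++ r [ false ]) r0∈S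

  r∈T : T r
  r∈T = proj₂ (proj₁ perfT) _ r (⊑-++ r [ true ]) r1∈T

  -- Every node is comparable with r, and no longer node is: r⁀0, r⁀1 ∈ S ∪ T.
  stem : IsStem (S ∪ T) r
  stem = inj₁ r∈S , ((λ x∈ → x∈ , hangs x∈) , proj₁) , maximal
    where
    hangs : Hangs r (S ∪ T)
    hangs (inj₁ x∈) = comparable-parent r false _ (hangS x∈)
    hangs (inj₂ x∈) = comparable-parent r true _ (hangT x∈)
    maximal : ∀ s → (S ∪ T) s → (S ∪ T) ≐ ((S ∪ T) ↾ s) → s ⊑ r
    maximal s _ (U⊆U↾s , _) = ⊑-fork r (comparable-sym (proj₂ (U⊆U↾s (inj₁ r0∈S))))
                                       (comparable-sym (proj₂ (U⊆U↾s (inj₂ r1∈T))))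

  left : S ≐ ((S ∪ T) ⟶ r [ false ])
  left = (λ x∈ → inj₁ x∈ , hangS x∈)
       , λ { (inj₁ x∈ , _) → x∈
           ; (inj₂ x∈ , cmp) → crossing-node r (proj₁ perfS) r∈S hangT x∈ cmp }

  right : T ≐ ((S ∪ T) ⟶ r [ true ])
  right = (λ x∈ → inj₂ x∈ , hangT x∈)
        , λ { (inj₂ x∈ , _) → x∈
            ; (inj₁ x∈ , cmp) → crossing-node r (proj₁ perfT) r∈T hangS x∈ cmp }

lemma3p1 : (R S T : StrSet) → LT R → LT S → LT T →
    (r sS sT σ : Str) → IsStem R r → IsStem S sS → IsStem T sT →
    S ⊆ (R ⟶ r [ false ]) → T ⊆ (R ⟶ r [ true ]) →
    T ≐ (σ ·ˢ S) → length σ ≤ length sS → length sS ≡ length sT →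
    LT (S ∪ T) × IsStem (S ∪ T) r
      × S ≐ ((S ∪ T) ⟶ r [ false ]) × T ≐ ((S ∪ T) ⟶ r [ true ])
lemma3p1 R S T _ (perfS , s₀ , stem₀ , q , lengths , heads , S≐₀) (perfT , _)
  r sS sT σ _ stemS stemT S⊆R₀ T⊆R₁ T≐σS σ≤sS lenST =
  (perfect-∪ perfS perfT , r , stem , fork a b ◃ q , proj₁ split′ , proj₂ split′ , U≐) ,
  stem , left , right
  where
  hangS : Hangs (r ++ [ false ]) S
  hangS x∈ = proj₂ (S⊆R₀ x∈)
  hangT : Hangs (r ++ [ true ]) T
  hangT x∈ = proj₂ (T⊆R₁ x∈)
  open Glue r perfS perfT hangS hangT
  stemS-split : ∃ λ a → sS ≡ r ++ false ∷ a
  stemS-split = hanging-stem r false perfS stemS hangS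
  stemT-split : ∃ λ b → sT ≡ r ++ true ∷ b
  stemT-split = hanging-stem r true perfT stemT hangT
  a b : Str
  a = proj₁ stemS-split
  b = proj₁ stemT-split
  split′ : Splitting (fork a b ◃ q)
  split′ = fork-splitting
    (length-after-fork r (proj₂ stemS-split) (proj₂ stemT-split) lenST) (lengths , heads)
  S≐ : S ≐ Branches sS q
  S≐ = subst (λ s → S ≐ Branches s q) (stem-unique stem₀ stemS) S≐₀
  σsS≡sT : σ · sS ≡ sT
  σsS≡sT = stem-by-length stemT (proj₂ T≐σS (sS , proj₁ stemS , refl))
                          (trans (·-length σ sS) lenST)
  U≐ : (S ∪ T) ≐ Branches r (fork a b ◃ q)
  U≐ = glue-branches r q S≐ (branches-translate (proj₁ perfT) T≐σS S≐ σ≤sS σsS≡sT)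
                     (proj₂ stemS-split) (proj₂ stemT-split)
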